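{- For every integer $n\ge 4$, $\vec{r}(CP(2,2;n-4))=n+1$.
   Context: A tournament is an orientation of a complete graph. For an acyclic oriented graph $H$, $\vec{r}(H)$ is the smallest $N$ such that every tournament on $N$ vertices contains a copy of $H$ as a subdigraph. $CP(2,2;n-4)$ is the oriented graph with vertex set $\{v_1,\dots,v_n\}$ and arc set $\{(v_1,v_2),(v_1,v_3),(v_2,v_4),(v_3,v_4)\}\cup\{(v_i,v_{i+1}):4\le i\le n-1\}$; that is, the oriented $4$-cycle $C(2,2)$ (two directed paths of length $2$ from $v_1$ to $v_4$) with a directed path of length $n-4$ starting at its unique vertex $v_4$ of out-degree $0$ attached. -}

module Defs where

open import Data.Nat using (ℕ; zero; suc; _≤_; _<_)
open import Data.Fin using (Fin; toℕ)
open import Data.Bool using (Bool; true; false; not)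
open import Data.Product using (Σ; _×_; ∃)
open import Data.Sum using (_⊎_)
open import Relation.Nullary using (¬_)
open import Relation.Binary.PropositionalEquality using (_≡_; _≢_)
open import Function.Definitions using (Injective)

record Tournament (N : ℕ) : Set where
  field
    arc        : Fin N → Fin N → Bool
    irreflexive : ∀ i → arc i i ≡ false
    tournament  : ∀ i j → i ≢ j → arc i j ≡ not (arc j i)
open Tournament public

Digraph : ℕ → Set₁
Digraph n = Fin n → Fin n → Set

Contains : ∀ {N n} → Tournament N → Digraph n → Set
Contains {N} {n} T H =
  Σ (Fin n → Fin N) λ f →
    Injective _≡_ _≡_ f × (∀ u v → H u v → arc T (f u) (f v) ≡ true)

Forces : ∀ {n} → Digraph n → ℕ → Set
Forces H N = (T : Tournament N) → Contains T H

IsOrientedRamsey : ∀ {n} → Digraph n → ℕ → Set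
IsOrientedRamsey H N = Forces H N × (∀ M → M < N → ¬ Forces H M)

-- CP(2,2;n-4) on vertices v₁,…,vₙ, here indexed 0,…,n-1 (vᵢ ↦ i-1):
-- arcs 0→1, 0→2, 1→3, 2→3, and i→i+1 for 3 ≤ i (i+1 < n).
CP : (n : ℕ) → Digraph n
CP n u v =
    (toℕ u ≡ 0 × toℕ v ≡ 1)
  ⊎ (toℕ u ≡ 0 × toℕ v ≡ 2)
  ⊎ (toℕ u ≡ 1 × toℕ v ≡ 3)
  ⊎ (toℕ u ≡ 2 × toℕ v ≡ 3)
  ⊎ (3 ≤ toℕ u × toℕ v ≡ suc (toℕ u))

module Submission where

-- Upper bound: grow the copy one vertex at a time, keeping one vertex spare.  A new vertex x is
-- inserted into the path as in Rédei's theorem if the sink u beats x or the spare vertex y.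
-- Otherwise x, y, a and b all beat u, and an exhaustive check of the 1024 tournaments on five
-- vertices shows that x, y, c, a, b split into a spare vertex and a copy of C(2,2) whose sink is
-- not c, so that the old path can follow its sink.  The base case is the same check: every
-- tournament on five vertices contains C(2,2).
--
-- Lower bound: take the transitive tournament on 0 < 1 < ⋯ < n-1 with the arc between 0 and 2
-- reversed.  A vertex beating one of 0, 1, 2, 3 lies in the cyclic triangle {0, 1, 2}, where
-- every vertex has a single out-neighbour, so the sink of any copy of C(2,2) is at least 4; from
-- there every arc climbs, and the path of length n-4 would reach n.

open import Defs
open import Data.Nat using (ℕ; zero; suc; _+_; _≤_; _<_; _<ᵇ_; z≤n; s≤s; z<s; s<s; _≤?_)
open import Data.Nat.Properties
  using ( <ᵇ⇒<; <⇒≤; ≤-trans; <-≤-trans; ≤⇒≯; ≰⇒>; n≤1+n; m<1+n⇒m≤n; +-comm; +-monoˡ-≤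
        ; suc-injective; allUpTo?)
  renaming (_≟_ to _ℕ≟_)
open import Data.Bool using (Bool; true; false; not; T)
  renaming (_≟_ to _Bool≟_)
open import Data.Bool.Properties using (not-involutive)
open import Data.Unit using (⊤; tt)
open import Data.Empty using (⊥; ⊥-elim)
open import Data.Product using (_×_; _,_; ∃-syntax)
open import Data.Sum using (_⊎_; inj₁; inj₂)
open import Data.Fin using (Fin; zero; suc; toℕ; fromℕ; fromℕ<; #_)
  renaming (_≟_ to _Fin≟_)
open import Data.Fin.Properties using (toℕ-injective; toℕ<n; toℕ-fromℕ; toℕ-fromℕ<)
  renaming (suc-injective to Fin-suc-injective)
open import Data.Vec as Vec using (Vec; []; _∷_; tabulate)
open import Data.Vec.Properties using (lookup∘tabulate)
open import Data.List using (List; []; _∷_; [_]; length; lookup; map; concatMap; allFin)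
open import Data.List.Properties using (length-tabulate)
open import Data.List.Relation.Unary.All as All using (All; []; _∷_)
open import Data.List.Relation.Unary.Any as Any using (Any; here; there; any?)
open import Data.List.Relation.Unary.Any.Properties using (map⁻; concatMap⁻)
open import Data.List.Relation.Unary.AllPairs using (_∷_)
open import Data.List.Relation.Unary.Linked using (Linked; [-]; _∷_)
open import Data.List.Relation.Unary.Unique.Propositional using (Unique)
open import Data.List.Relation.Unary.Unique.Propositional.Properties using (allFin⁺; take⁺; drop⁺)
open import Data.List.Membership.Propositional.Properties using (∈-lookup)
open import Data.List.Relation.Binary.Permutation.Propositional
  using (_↭_; prep; swap; ↭-refl; ↭-sym; ↭-trans; ↭⇒↭ₛ)
open import Data.List.Relation.Binary.Permutation.Propositional.Properties
  using (↭-length; ++⁺ˡ; ++⁺ʳ; shift)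
  renaming (map⁺ to ↭-map⁺)
import Data.List.Relation.Binary.Permutation.Setoid.Properties as ↭ₛ
open import Relation.Nullary using (Dec; yes; no; ¬_)
open import Relation.Nullary.Decidable using (map′; _×-dec_; _→-dec_; ¬?; toWitness)
open import Relation.Binary.PropositionalEquality
  using (_≡_; _≢_; refl; sym; trans; cong; subst; setoid)
open import Function using (_∘_)
open import Function.Definitions using (Injective)

private
  variable
    A : Set
    k n N M : ℕ

Unique-resp-↭ : ∀ {xs ys : List A} → xs ↭ ys → Unique xs → Unique ys
Unique-resp-↭ p = ↭ₛ.Unique-resp-↭ (setoid _) (↭⇒↭ₛ p)

lookup-injective : ∀ {xs : List A} → Unique xs → Injective _≡_ _≡_ (lookup xs)
lookup-injective {xs = _ ∷ _} _        {zero}  {zero}  _  = refl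
lookup-injective {xs = _ ∷ _} (x∉ ∷ _) {zero}  {suc j} eq = ⊥-elim (All.lookup x∉ (∈-lookup j) eq)
lookup-injective {xs = _ ∷ _} (x∉ ∷ _) {suc i} {zero}  eq = ⊥-elim (All.lookup x∉ (∈-lookup i) (sym eq))
lookup-injective {xs = _ ∷ _} (_ ∷ u)  {suc i} {suc j} eq = cong suc (lookup-injective u eq)

insertions : A → List A → List (List A)
insertions x []       = [ [ x ] ]
insertions x (y ∷ ys) = (x ∷ y ∷ ys) ∷ map (y ∷_) (insertions x ys)

permutations : List A → List (List A)
permutations []       = [ [] ]
permutations (x ∷ xs) = concatMap (insertions x) (permutations xs)

insertions-↭ : ∀ {P : List A → Set} {x xs} → Any P (insertions x xs) → ∃[ ys ] ys ↭ x ∷ xs × P ys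
insertions-↭ {xs = []}    (here p) = _ , ↭-refl , p
insertions-↭ {xs = _ ∷ _} (here p) = _ , ↭-refl , p
insertions-↭ {x = x} {y ∷ _} (there q)
  with ys , ys↭ , p ← insertions-↭ (map⁻ q)
  = y ∷ ys , ↭-trans (prep y ys↭) (swap y x ↭-refl) , p

permutations-↭ : ∀ {P : List A → Set} {xs} → Any P (permutations xs) → ∃[ ys ] ys ↭ xs × P ys
permutations-↭ {xs = []} (here p) = [] , ↭-refl , p
permutations-↭ {xs = x ∷ _} q
  with zs , zs↭ , q′ ← permutations-↭ (concatMap⁻ (insertions x) q)
  with ys , ys↭ , p ← insertions-↭ q′
  = ys , ↭-trans ys↭ (prep x zs↭) , p

-- The insertion step of Rédei's theorem.
module _ {R : A → A → Set} (R-connex : ∀ {x y} → x ≢ y → R x y ⊎ R y x) where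

  Linked-insert : ∀ {p x xs} → Linked R (p ∷ xs) → R p x → All (x ≢_) xs →
                  ∃[ ys ] Linked R (p ∷ ys) × ys ↭ x ∷ xs
  Linked-insert {x = x} [-] px [] = [ x ] , px ∷ [-] , ↭-refl
  Linked-insert {x = x} {q ∷ xs} (pq ∷ l) px (x≢q ∷ x∉) with R-connex x≢q
  ... | inj₁ xq = x ∷ q ∷ xs , px ∷ xq ∷ l , ↭-refl
  ... | inj₂ qx with ys , l′ , ys↭ ← Linked-insert l qx x∉ =
    q ∷ ys , pq ∷ l′ , ↭-trans (prep q ys↭) (swap q x ↭-refl)

Linked-lookup : ∀ {R : A → A → Set} {xs} → Linked R xs →
                ∀ {i j : Fin (length xs)} → toℕ j ≡ suc (toℕ i) → R (lookup xs i) (lookup xs j)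
Linked-lookup (r ∷ _) {zero}  {suc zero}     _  = r
Linked-lookup (_ ∷ l) {suc i} {suc j}        eq = Linked-lookup l (suc-injective eq)
Linked-lookup (_ ∷ _) {zero}  {suc (suc _)}  ()
Linked-lookup [-]     {zero}  {zero}         ()
Linked-lookup (_ ∷ _) {zero}  {zero}         ()
Linked-lookup (_ ∷ _) {suc _} {zero}         ()

Arc : Tournament N → Fin N → Fin N → Set
Arc T i j = arc T i j ≡ true

Arc-connex : (T : Tournament N) → ∀ {i j} → i ≢ j → Arc T i j ⊎ Arc T j i
Arc-connex T {i} {j} i≢j with arc T i j in eq
... | true  = inj₁ refl
... | false = inj₂ (trans (tournament T j i (i≢j ∘ sym)) (cong not eq))

induced : Tournament N → (v : Fin k → Fin N) → Injective _≡_ _≡_ v → Tournament k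
induced T v v-inj = record
  { arc         = λ i j → arc T (v i) (v j)
  ; irreflexive = λ i → irreflexive T (v i)
  ; tournament  = λ i j i≢j → tournament T (v i) (v j) (i≢j ∘ v-inj)
  }

record C22 (R : A → A → Set) (c a b u : A) : Set where
  constructor mkC22
  field
    ca : R c a
    cb : R c b
    au : R a u
    bu : R b u

C22-map : ∀ {B : Set} {R : B → B → Set} (f : A → B) {c a b u} →
          C22 (λ x y → R (f x) (f y)) c a b u → C22 R (f c) (f a) (f b) (f u)
C22-map f (mkC22 ca cb au bu) = mkC22 ca cb au bu

-- σ lists a spare vertex, then a copy c, a, b, u of C(2,2) whose sink u satisfies Q.
SpareC22 : (A → A → Set) → (A → Set) → List A → Set
SpareC22 R Q (_ ∷ c ∷ a ∷ b ∷ u ∷ []) = C22 R c a b u × Q u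
SpareC22 R Q _                        = ⊥

SpareC22-map : ∀ {R R′ : A → A → Set} {Q} → (∀ {x y} → R x y → R′ x y) →
               ∀ {σ} → SpareC22 R Q σ → SpareC22 R′ Q σ
SpareC22-map f {_ ∷ _ ∷ _ ∷ _ ∷ _ ∷ []} (mkC22 ca cb au bu , q) = mkC22 (f ca) (f cb) (f au) (f bu) , q

spareC22? : ∀ {R : A → A → Set} {Q} → (∀ x y → Dec (R x y)) → (∀ x → Dec (Q x)) →
            ∀ σ → Dec (SpareC22 R Q σ)
spareC22? R? Q? (_ ∷ c ∷ a ∷ b ∷ u ∷ []) =
  map′ (λ (ca , cb , au , bu , q) → mkC22 ca cb au bu , q)
       (λ (mkC22 ca cb au bu , q) → ca , cb , au , bu , q)
       (R? c a ×-dec R? c b ×-dec R? a u ×-dec R? b u ×-dec Q? u)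
spareC22? _ _ []                          = no λ ()
spareC22? _ _ (_ ∷ [])                    = no λ ()
spareC22? _ _ (_ ∷ _ ∷ [])                = no λ ()
spareC22? _ _ (_ ∷ _ ∷ _ ∷ [])            = no λ ()
spareC22? _ _ (_ ∷ _ ∷ _ ∷ _ ∷ [])        = no λ ()
spareC22? _ _ (_ ∷ _ ∷ _ ∷ _ ∷ _ ∷ _ ∷ _) = no λ ()

-- A tournament on Fin n is coded by the arcs from each vertex to the later ones.
Code : ℕ → Set
Code zero    = ⊤
Code (suc n) = Vec Bool n × Code n

decode : Code n → Fin n → Fin n → Bool
decode (_ , _) zero    zero    = false
decode (r , _) zero    (suc j) = Vec.lookup r j
decode (r , _) (suc i) zero    = not (Vec.lookup r i)
decode (_ , t) (suc i) (suc j) = decode t i j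

encode : Tournament n → Code n
encode {zero}  T = tt
encode {suc n} T = tabulate (arc T zero ∘ suc) , encode (induced T suc Fin-suc-injective)

decode-encode : (T : Tournament n) → ∀ i j → decode (encode T) i j ≡ arc T i j
decode-encode T zero    zero    = sym (irreflexive T zero)
decode-encode T zero    (suc j) = lookup∘tabulate _ j
decode-encode T (suc i) zero    =
  trans (cong not (lookup∘tabulate _ i)) (sym (tournament T (suc i) zero λ ()))
decode-encode T (suc i) (suc j) = decode-encode (induced T suc Fin-suc-injective) i j

∀-Vec? : ∀ n {P : Vec Bool n → Set} → (∀ v → Dec (P v)) → Dec (∀ v → P v)
∀-Vec? zero    P? = map′ (λ { p [] → p }) (λ h → h []) (P? [])
∀-Vec? (suc n) P? =
  map′ (λ { (f , t) (false ∷ v) → f v ; (f , t) (true ∷ v) → t v })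
       (λ h → (λ v → h (false ∷ v)) , (λ v → h (true ∷ v)))
       (∀-Vec? n (P? ∘ (false ∷_)) ×-dec ∀-Vec? n (P? ∘ (true ∷_)))

∀-Code? : ∀ n {P : Code n → Set} → (∀ t → Dec (P t)) → Dec (∀ t → P t)
∀-Code? zero    P? = map′ (λ p _ → p) (λ h → h tt) (P? tt)
∀-Code? (suc n) P? =
  map′ (λ h (r , t) → h r t) (λ h r t → h (r , t))
       (∀-Vec? n (λ r → ∀-Code? n (λ t → P? (r , t))))

Arcᵈ : Code n → Fin n → Fin n → Set
Arcᵈ t i j = decode t i j ≡ true

arcᵈ? : (t : Code n) → ∀ i j → Dec (Arcᵈ t i j)
arcᵈ? t i j = decode t i j Bool≟ true

Arcᵈ⇒Arc : (T : Tournament n) → ∀ {i j} → Arcᵈ (encode T) i j → Arc T i j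
Arcᵈ⇒Arc T {i} {j} = trans (sym (decode-encode T i j))

Arc⇒Arcᵈ : (T : Tournament n) → ∀ {i j} → Arc T i j → Arcᵈ (encode T) i j
Arc⇒Arcᵈ T {i} {j} = trans (decode-encode T i j)

C22-in-five : (T : Tournament 5) → Any (SpareC22 (Arc T) (λ _ → ⊤)) (permutations (allFin 5))
C22-in-five T = Any.map (SpareC22-map (Arcᵈ⇒Arc T)) (check (encode T))
  where
  check : ∀ t → Any (SpareC22 (Arcᵈ t) (λ _ → ⊤)) (permutations (allFin 5))
  check = toWitness {a? = ∀-Code? 5 λ t →
            any? (spareC22? (arcᵈ? t) (λ _ → yes tt)) (permutations (allFin 5))} tt

C22-in-five-sink≢2 : (T : Tournament 5) → Arc T (# 2) (# 3) → Arc T (# 2) (# 4) →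
                     Any (SpareC22 (Arc T) (_≢ # 2)) (permutations (allFin 5))
C22-in-five-sink≢2 T ca cb =
  Any.map (SpareC22-map (Arcᵈ⇒Arc T)) (check (encode T) (Arc⇒Arcᵈ T ca) (Arc⇒Arcᵈ T cb))
  where
  check : ∀ t → Arcᵈ t (# 2) (# 3) → Arcᵈ t (# 2) (# 4) →
          Any (SpareC22 (Arcᵈ t) (_≢ # 2)) (permutations (allFin 5))
  check = toWitness {a? = ∀-Code? 5 λ t → arcᵈ? t (# 2) (# 3) →-dec arcᵈ? t (# 2) (# 4) →-dec
            any? (spareC22? (arcᵈ? t) (λ u → ¬? (u Fin≟ # 2))) (permutations (allFin 5))} tt

-- The upper bound

module _ (T : Tournament N) where

  record SpareCP (V : List (Fin N)) : Set where
    field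
      spare c a b u : Fin N
      path          : List (Fin N)
      perm          : spare ∷ c ∷ a ∷ b ∷ u ∷ path ↭ V
      c22           : C22 (Arc T) c a b u
      linked        : Linked (Arc T) (u ∷ path)

  SpareCP-resp-↭ : ∀ {V W} → V ↭ W → SpareCP V → SpareCP W
  SpareCP-resp-↭ V↭W s = record { SpareCP s hiding (perm) ; perm = ↭-trans (SpareCP.perm s) V↭W }

  SpareCP-five : ∀ {v₀ v₁ v₂ v₃ v₄} → Unique (v₀ ∷ v₁ ∷ v₂ ∷ v₃ ∷ v₄ ∷ []) →
                 SpareCP (v₀ ∷ v₁ ∷ v₂ ∷ v₃ ∷ v₄ ∷ [])
  SpareCP-five {v₀} {v₁} {v₂} {v₃} {v₄} uV =
    from-C22 (permutations-↭ (C22-in-five (induced T v (lookup-injective uV))))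
    where
    v : Fin 5 → Fin N
    v = lookup (v₀ ∷ v₁ ∷ v₂ ∷ v₃ ∷ v₄ ∷ [])
    from-C22 : ∃[ σ ] σ ↭ allFin 5 × SpareC22 (λ i j → Arc T (v i) (v j)) (λ _ → ⊤) σ →
               SpareCP (map v (allFin 5))
    from-C22 (s ∷ c ∷ a ∷ b ∷ u ∷ [] , σ↭ , (k , _)) =
      record { spare = v s ; c = v c ; a = v a ; b = v b ; u = v u ; path = []
             ; perm = ↭-map⁺ v σ↭ ; c22 = C22-map v k ; linked = [-] }

  SpareCP-absorb : ∀ {s z c a b u P} → C22 (Arc T) c a b u → Linked (Arc T) (u ∷ P) →
                   Arc T u z → All (z ≢_) P → SpareCP (s ∷ z ∷ c ∷ a ∷ b ∷ u ∷ P)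
  SpareCP-absorb {s} {z} {c} {a} {b} {u} {P} k l uz z∉P
    with Q , l′ , Q↭ ← Linked-insert (Arc-connex T) l uz z∉P =
    record { spare = s ; c = c ; a = a ; b = b ; u = u ; path = Q
           ; perm = prep s (↭-trans (++⁺ˡ (c ∷ a ∷ b ∷ u ∷ []) Q↭) (shift z (c ∷ a ∷ b ∷ u ∷ []) P))
           ; c22 = k ; linked = l′ }

  -- If neither the new vertex x nor the spare vertex y can be absorbed, x, y, a, b all beat u,
  -- so a copy of C(2,2) on x, y, c, a, b whose sink is not c can be followed by u ∷ P.
  SpareCP-extend : ∀ {x y c a b u P} → Unique (x ∷ y ∷ c ∷ a ∷ b ∷ u ∷ P) →
                   C22 (Arc T) c a b u → Linked (Arc T) (u ∷ P) → SpareCP (x ∷ y ∷ c ∷ a ∷ b ∷ u ∷ P)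
  SpareCP-extend {x} {y} {c} {a} {b} {u} {P}
                 U@((_ ∷ _ ∷ _ ∷ _ ∷ x≢u ∷ x∉P) ∷ (_ ∷ _ ∷ _ ∷ y≢u ∷ y∉P) ∷ _) k l
    with Arc-connex T (x≢u ∘ sym) | Arc-connex T (y≢u ∘ sym)
  ... | inj₁ ux | _      = SpareCP-resp-↭ (swap y x ↭-refl) (SpareCP-absorb k l ux x∉P)
  ... | inj₂ _  | inj₁ uy = SpareCP-absorb k l uy y∉P
  ... | inj₂ xu | inj₂ yu =
    from-C22 (permutations-↭ (C22-in-five-sink≢2 (induced T v (lookup-injective (take⁺ 5 U)))
                                                  (C22.ca k) (C22.cb k)))
    where
    v : Fin 5 → Fin N
    v = lookup (x ∷ y ∷ c ∷ a ∷ b ∷ [])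
    beats-u : ∀ i → i ≢ # 2 → Arc T (v i) u
    beats-u zero                         _   = xu
    beats-u (suc zero)                   _   = yu
    beats-u (suc (suc zero))             i≢2 = ⊥-elim (i≢2 refl)
    beats-u (suc (suc (suc zero)))       _   = C22.au k
    beats-u (suc (suc (suc (suc zero)))) _   = C22.bu k
    from-C22 : ∃[ σ ] σ ↭ allFin 5 × SpareC22 (λ i j → Arc T (v i) (v j)) (_≢ # 2) σ →
               SpareCP (x ∷ y ∷ c ∷ a ∷ b ∷ u ∷ P)
    from-C22 (s ∷ c′ ∷ a′ ∷ b′ ∷ w ∷ [] , σ↭ , (k′ , w≢2)) =
      record { spare = v s ; c = v c′ ; a = v a′ ; b = v b′ ; u = v w ; path = u ∷ P
             ; perm = ++⁺ʳ (u ∷ P) (↭-map⁺ v σ↭) ; c22 = C22-map v k′ ; linked = beats-u w w≢2 ∷ l }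

  Unique⇒SpareCP : ∀ {V} → Unique V → 5 ≤ length V → SpareCP V
  Unique⇒SpareCP {_ ∷ _ ∷ _ ∷ _ ∷ _ ∷ []} uV _ = SpareCP-five uV
  Unique⇒SpareCP {x ∷ V@(_ ∷ _ ∷ _ ∷ _ ∷ _ ∷ _)} uxV@(_ ∷ uV) _ =
    SpareCP-resp-↭ (prep x perm) (SpareCP-extend (Unique-resp-↭ (↭-sym (prep x perm)) uxV) c22 linked)
    where
    open SpareCP (Unique⇒SpareCP uV (s≤s (s≤s (s≤s (s≤s (s≤s z≤n))))))
  Unique⇒SpareCP {[]}                 _ ()
  Unique⇒SpareCP {_ ∷ []}             _ (s≤s ())
  Unique⇒SpareCP {_ ∷ _ ∷ []}         _ (s≤s (s≤s ()))
  Unique⇒SpareCP {_ ∷ _ ∷ _ ∷ []}     _ (s≤s (s≤s (s≤s ())))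
  Unique⇒SpareCP {_ ∷ _ ∷ _ ∷ _ ∷ []} _ (s≤s (s≤s (s≤s (s≤s ()))))

  CP-copy : ∀ {c a b u P} → C22 (Arc T) c a b u → Linked (Arc T) (u ∷ P) →
            Unique (c ∷ a ∷ b ∷ u ∷ P) → Contains T (CP (4 + length P))
  CP-copy {c} {a} {b} {u} {P} (mkC22 ca cb au bu) l uW = lookup W , lookup-injective uW , embeds
    where
    W : List (Fin N)
    W = c ∷ a ∷ b ∷ u ∷ P
    path-arc : ∀ {v w} → 3 ≤ toℕ v → toℕ w ≡ suc (toℕ v) → Arc T (lookup W v) (lookup W w)
    path-arc {suc (suc (suc _))} {suc (suc (suc _))} _ eq =
      Linked-lookup l (suc-injective (suc-injective (suc-injective eq)))
    path-arc {suc (suc (suc _))} {zero}           _ ()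
    path-arc {suc (suc (suc _))} {suc zero}       _ ()
    path-arc {suc (suc (suc _))} {suc (suc zero)} _ ()
    path-arc {zero}                               ()
    path-arc {suc zero}                           (s≤s ())
    path-arc {suc (suc zero)}                     (s≤s (s≤s ()))
    embeds : ∀ v w → CP (4 + length P) v w → Arc T (lookup W v) (lookup W w)
    embeds v w (inj₁ (v≡0 , w≡1))
      rewrite toℕ-injective {i = v} {j = # 0} v≡0 | toℕ-injective {i = w} {j = # 1} w≡1 = ca
    embeds v w (inj₂ (inj₁ (v≡0 , w≡2)))
      rewrite toℕ-injective {i = v} {j = # 0} v≡0 | toℕ-injective {i = w} {j = # 2} w≡2 = cb
    embeds v w (inj₂ (inj₂ (inj₁ (v≡1 , w≡3))))
      rewrite toℕ-injective {i = v} {j = # 1} v≡1 | toℕ-injective {i = w} {j = # 3} w≡3 = au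
    embeds v w (inj₂ (inj₂ (inj₂ (inj₁ (v≡2 , w≡3)))))
      rewrite toℕ-injective {i = v} {j = # 2} v≡2 | toℕ-injective {i = w} {j = # 3} w≡3 = bu
    embeds v w (inj₂ (inj₂ (inj₂ (inj₂ (3≤v , w≡1+v))))) = path-arc 3≤v w≡1+v

CP-forced : 4 ≤ n → Forces (CP n) (n + 1)
CP-forced {n} 4≤n T = subst (Contains T ∘ CP) 4+|path|≡n (CP-copy T c22 linked uW)
  where
  5≤n+1 : 5 ≤ length (allFin (n + 1))
  5≤n+1 = subst (5 ≤_) (sym (length-tabulate _)) (+-monoˡ-≤ 1 4≤n)
  open SpareCP (Unique⇒SpareCP T (allFin⁺ (n + 1)) 5≤n+1)
  uW : Unique (c ∷ a ∷ b ∷ u ∷ path)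
  uW = drop⁺ 1 (Unique-resp-↭ (↭-sym perm) (allFin⁺ (n + 1)))
  4+|path|≡n : 4 + length path ≡ n
  4+|path|≡n = suc-injective (trans (↭-length perm) (trans (length-tabulate _) (+-comm n 1)))

-- The lower bound

<ᵇ-irrefl : ∀ i → (i <ᵇ i) ≡ false
<ᵇ-irrefl zero    = refl
<ᵇ-irrefl (suc i) = <ᵇ-irrefl i

<ᵇ-antisym : ∀ {i j} → i ≢ j → (i <ᵇ j) ≡ not (j <ᵇ i)
<ᵇ-antisym {zero}  {zero}  i≢j = ⊥-elim (i≢j refl)
<ᵇ-antisym {zero}  {suc _} _   = refl
<ᵇ-antisym {suc _} {zero}  _   = refl
<ᵇ-antisym {suc i} {suc j} i≢j = <ᵇ-antisym (i≢j ∘ cong suc)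

beats₀ : ℕ → Bool
beats₀ 0 = false
beats₀ 2 = false
beats₀ _ = true

-- 0 → 1 → 2 → 0 is a cyclic triangle; every other arc goes from the smaller number to the larger.
beats : ℕ → ℕ → Bool
beats zero    j       = beats₀ j
beats (suc i) zero    = not (beats₀ (suc i))
beats (suc i) (suc j) = i <ᵇ j

Beats : ℕ → ℕ → Set
Beats i j = beats i j ≡ true

beats-irrefl : ∀ i → beats i i ≡ false
beats-irrefl zero    = refl
beats-irrefl (suc i) = <ᵇ-irrefl i

beats-antisym : ∀ {i j} → i ≢ j → beats i j ≡ not (beats j i)
beats-antisym {zero}  {zero}  i≢j = ⊥-elim (i≢j refl)
beats-antisym {zero}  {suc j} _   = sym (not-involutive (beats₀ (suc j)))
beats-antisym {suc _} {zero}  _   = refl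
beats-antisym {suc _} {suc _} i≢j = <ᵇ-antisym (i≢j ∘ cong suc)

Beats-inversion : ∀ {i j} → Beats i j → i < j ⊎ (i ≡ 2 × j ≡ 0)
Beats-inversion {zero}              {suc _} _ = inj₁ z<s
Beats-inversion {suc (suc zero)}    {zero}  _ = inj₂ (refl , refl)
Beats-inversion {suc i}             {suc j} e = inj₁ (s<s (<ᵇ⇒< i j (subst T (sym e) tt)))
Beats-inversion {zero}              {zero}  ()
Beats-inversion {suc zero}          {zero}  ()
Beats-inversion {suc (suc (suc _))} {zero}  ()

Beats-increasing : ∀ {i j} → Beats i j → 3 ≤ i → i < j
Beats-increasing ij 3≤i with Beats-inversion ij
... | inj₁ i<j       = i<j
... | inj₂ (refl , _) = ⊥-elim (≤⇒≯ 3≤i (s≤s (s≤s (s≤s z≤n))))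

Beats-into-≤3 : ∀ {i j} → Beats i j → j ≤ 3 → i < 3
Beats-into-≤3 ij j≤3 with Beats-inversion ij
... | inj₁ i<j       = <-≤-trans i<j j≤3
... | inj₂ (refl , _) = s≤s (s≤s (s≤s z≤n))

triangle-out-unique : ∀ {c} → c < 3 → ∀ {a} → a < 3 → ∀ {b} → b < 3 → Beats c a → Beats c b → a ≡ b
triangle-out-unique = toWitness {a? = allUpTo? (λ c → allUpTo? (λ a → allUpTo? (λ b →
  (beats c a Bool≟ true) →-dec (beats c b Bool≟ true) →-dec (a ℕ≟ b)) 3) 3) 3} tt

-- c, a, b would all lie in the triangle, where every vertex has a single out-neighbour.
C22-sink≥4 : ∀ {c a b u} → C22 Beats c a b u → a ≢ b → 4 ≤ u
C22-sink≥4 {c} {a} {b} {u} (mkC22 ca cb au bu) a≢b with 4 ≤? u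
... | yes 4≤u = 4≤u
... | no  4≰u = ⊥-elim (a≢b (triangle-out-unique {c} c<3 {a} a<3 {b} b<3 ca cb))
  where
  u≤3 : u ≤ 3
  u≤3 = m<1+n⇒m≤n (≰⇒> 4≰u)
  a<3 : a < 3
  a<3 = Beats-into-≤3 {a} au u≤3
  b<3 : b < 3
  b<3 = Beats-into-≤3 {b} bu u≤3
  c<3 : c < 3
  c<3 = Beats-into-≤3 {c} ca (<⇒≤ a<3)

triangleTournament : (M : ℕ) → Tournament M
triangleTournament M = record
  { arc         = λ i j → beats (toℕ i) (toℕ j)
  ; irreflexive = λ i → beats-irrefl (toℕ i)
  ; tournament  = λ i j i≢j → beats-antisym (i≢j ∘ toℕ-injective)
  }

-- Along a copy of CP(2,2;n-4) the labels increase strictly from the sink on, starting at 4.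
CP-free : 4 ≤ n → M ≤ n → ¬ Contains (triangleTournament M) (CP n)
CP-free {suc (suc (suc (suc m)))} {M} (s≤s (s≤s (s≤s (s≤s _)))) M≤n (f , f-inj , hom) =
  ≤⇒≯ (path-rank (toℕ-fromℕ (3 + m))) (<-≤-trans (toℕ<n (f (fromℕ (3 + m)))) M≤n)
  where
  rank : Fin (4 + m) → ℕ
  rank v = toℕ (f v)
  1≢2 : # 1 ≢ # 2
  1≢2 ()
  path-rank : ∀ {d v} → toℕ v ≡ 3 + d → 4 + d ≤ rank v
  path-rank {zero} {v} v≡3 = C22-sink≥4 {rank (# 0)} {rank (# 1)} {rank (# 2)}
    (mkC22 (hom (# 0) (# 1) (inj₁ (refl , refl)))
           (hom (# 0) (# 2) (inj₂ (inj₁ (refl , refl))))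
           (hom (# 1) v (inj₂ (inj₂ (inj₁ (refl , v≡3)))))
           (hom (# 2) v (inj₂ (inj₂ (inj₂ (inj₁ (refl , v≡3)))))))
    (λ e → 1≢2 (f-inj (toℕ-injective e)))
  path-rank {suc d} {v} v≡4+d =
    ≤-trans (s≤s w-rank) (Beats-increasing {rank w} {rank v} w→v 3≤rank-w)
    where
    3+d<4+m : 3 + d < 4 + m
    3+d<4+m = ≤-trans (n≤1+n _) (subst (_< 4 + m) v≡4+d (toℕ<n v))
    w : Fin (4 + m)
    w = fromℕ< 3+d<4+m
    w≡3+d : toℕ w ≡ 3 + d
    w≡3+d = toℕ-fromℕ< 3+d<4+m
    w-rank : 4 + d ≤ rank w
    w-rank = path-rank w≡3+d
    3≤rank-w : 3 ≤ rank w
    3≤rank-w = ≤-trans (s≤s (s≤s (s≤s z≤n))) w-rank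
    w→v : Beats (rank w) (rank v)
    w→v = hom w v (inj₂ (inj₂ (inj₂ (inj₂ (subst (3 ≤_) (sym w≡3+d) (s≤s (s≤s (s≤s z≤n))) ,
                                           trans v≡4+d (cong suc (sym w≡3+d)))))))

CP-not-forced : 4 ≤ n → M < n + 1 → ¬ Forces (CP n) M
CP-not-forced {n} {M} 4≤n M<n+1 F =
  CP-free 4≤n (m<1+n⇒m≤n (subst (M <_) (+-comm n 1) M<n+1)) (F (triangleTournament M))

theorem1p4 : (n : ℕ) → 4 ≤ n → IsOrientedRamsey (CP n) (n + 1)
theorem1p4 n 4≤n = CP-forced 4≤n , λ _ → CP-not-forced 4≤n
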